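{- For all positive integers $n$ and $k$, the posets $\widetilde{\mathrm{NC}}^{(2k)}(2n+1)$ and $\mathrm{NC}^{(2k)}(n;k)$ are isomorphic.
   Context: A partition $\pi$ of $[N]$ is noncrossing if there are no $a<b<c<d$ with $a,c$ in a block $B$ and $b,d$ in a block $B'\ne B$; $\mathrm{NC}(N)$ is the poset of noncrossing partitions of $[N]$ ordered by refinement ($\pi\le\sigma$ iff each block of $\sigma$ is a union of blocks of $\pi$). For positive integers $m,N$, $\mathrm{NC}^{(m)}(N)$ is the subposet of $\mathrm{NC}(mN)$ of partitions all of whose block sizes are divisible by $m$. Let $M=2k(2n+1)$ and $\rho(i)\equiv i+(2kn+k)\pmod M$ on $[M]$; $\widetilde{\mathrm{NC}}^{(2k)}(2n+1)$ is the subposet of $\mathrm{NC}^{(2k)}(2n+1)$ of partitions invariant under $\rho$ ($\rho(B)$ is a block whenever $B$ is). For integers $0<r<m$, $\mathrm{NC}^{(m)}(n;r)$ is the subposet of $\mathrm{NC}(mn+r)$ consisting of the partitions all but one of whose blocks have size divisible by $m$. -}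

module Defs where

open import Data.Nat using (ℕ; zero; suc; _+_; _*_)
open import Data.Nat.Divisibility using (_∣_)
open import Data.Nat.DivMod using (_mod_)
open import Data.Fin using (Fin; toℕ; _<_)
open import Data.Bool using (Bool; true; false; if_then_else_)
open import Data.List using (List; map; allFin)
open import Data.Nat.ListAction using (sum)
open import Data.Product using (Σ; ∃; _×_; proj₁)
open import Data.Empty using (⊥-elim)
open import Relation.Nullary using (¬_)
open import Relation.Binary.PropositionalEquality using (_≡_)

-- A set partition of [N] (modelled as Fin N = {0,…,N-1}), given by its
-- decidable "lies in the same block" equivalence relation.
record Partition (N : ℕ) : Set where
  field
    rel     : Fin N → Fin N → Bool
    rel-refl  : ∀ i → rel i i ≡ true
    rel-sym   : ∀ i j → rel i j ≡ true → rel j i ≡ true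
    rel-trans : ∀ i j l → rel i j ≡ true → rel j l ≡ true → rel i l ≡ true
open Partition public

_∋_∼_ : ∀ {N} → Partition N → Fin N → Fin N → Set
π ∋ i ∼ j = rel π i j ≡ true

_⊑_ : ∀ {N} → Partition N → Partition N → Set
π ⊑ σ = ∀ i j → π ∋ i ∼ j → σ ∋ i ∼ j

blockSize : ∀ {N} → Partition N → Fin N → ℕ
blockSize {N} π i = sum (map (λ j → if rel π i j then 1 else 0) (allFin N))

NonCrossing : ∀ {N} → Partition N → Set
NonCrossing π = ∀ a b c d →
  ¬ (a < b × b < c × c < d × π ∋ a ∼ c × π ∋ b ∼ d × ¬ (π ∋ a ∼ b))

AllBlocksDiv : ∀ {N} → ℕ → Partition N → Set
AllBlocksDiv m π = ∀ i → m ∣ blockSize π i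

AllButOneDiv : ∀ {N} → ℕ → Partition N → Set
AllButOneDiv {N} m π = Σ (Fin N) λ i₀ → ∀ j → ¬ (π ∋ i₀ ∼ j) → m ∣ blockSize π j

shift : ∀ {M} → ℕ → Fin M → Fin M
shift {zero}  s ()
shift {suc M} s i = (toℕ i + s) mod (suc M)

Invariant : ∀ {M} → (Fin M → Fin M) → Partition M → Set
Invariant ρ π = ∀ i j → (π ∋ i ∼ j → π ∋ ρ i ∼ ρ j) × (π ∋ ρ i ∼ ρ j → π ∋ i ∼ j)

NCm : ℕ → ℕ → Set
NCm m N = Σ (Partition (m * N)) λ π → NonCrossing π × AllBlocksDiv m π

NCtilde : ℕ → ℕ → Set
NCtilde k n = Σ (NCm (2 * k) (2 * n + 1)) λ x → Invariant (shift (2 * k * n + k)) (proj₁ x)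

NCr : ℕ → ℕ → ℕ → Set
NCr m n r = Σ (Partition (m * n + r)) λ π → NonCrossing π × AllButOneDiv m π

_≤NCtilde_ : ∀ {k n} → NCtilde k n → NCtilde k n → Set
x ≤NCtilde y = proj₁ (proj₁ x) ⊑ proj₁ (proj₁ y)

_≤NCr_ : ∀ {m n r} → NCr m n r → NCr m n r → Set
x ≤NCr y = proj₁ x ⊑ proj₁ y

-- isomorphism of posets (equality on a poset = x ≤ y and y ≤ x):
-- monotone maps in both directions which are mutually inverse
record OrderIso {A B : Set} (_≤A_ : A → A → Set) (_≤B_ : B → B → Set) : Set where
  field
    to       : A → B
    from     : B → A
    to-mono  : ∀ {x y} → x ≤A y → to x ≤B to y
    from-mono : ∀ {x y} → x ≤B y → from x ≤A from y
    from-to  : ∀ x → (from (to x) ≤A x) × (x ≤A from (to x))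
    to-from  : ∀ y → (to (from y) ≤B y) × (y ≤B to (from y))

-- Put H = k(2n + 1), M = 2H and d = 2k, so that ρ is i ↦ i + H on [M]; all the arithmetic needed is
-- d ∣ 2H and d ∤ H. A ρ-invariant noncrossing partition of [M] folds to a noncrossing partition of
-- [M]/ρ ≅ [H]. Its blocks come from pairs B ≠ ρB, of the same size as B, or from ρ-invariant blocks;
-- two invariant blocks would cross, and since d ∤ H there is at least one, so all blocks but one have size
-- divisible by d. Conversely, given σ with special block B₀ of least element c, double B₀ to
-- B₀ ∪ (B₀ + H) and lift every other block to its two copies inside and outside the window
-- [c, c + H). Rotated by c this is the doubling of a noncrossing partition along the halves of [M],
-- hence noncrossing, and its block sizes |B| and 2|B₀| = 2H − 2 Σ |B| are divisible by d. The maps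
-- are monotone and mutually inverse because a block avoiding the central block of c and c + H cannot
-- cross it, so it lies on one side of the window.

module Submission where

open import Defs
open import Data.Nat using (ℕ; _≥_; _*_)

open import Data.Nat.Base using (zero; suc; pred; _+_; _∸_; _<_; _≤_; _<ᵇ_; _≡ᵇ_; _%_; s≤s; z≤n; NonZero)
open import Data.Nat.Properties
open import Data.Nat.DivMod
open import Data.Nat.Divisibility
open import Data.Nat.Solver using (module +-*-Solver)
open import Algebra.Properties.CommutativeSemigroup +-commutativeSemigroup using () renaming (interchange to +-interchange)
open import Data.Bool.Base using (Bool; true; false; _∧_; _∨_; _xor_; not; if_then_else_)
open import Data.Bool.Properties using (∨-comm; ∧-identityʳ; ∧-zeroʳ; not-involutive; not-¬; ¬-not)
open import Data.Fin.Base using (Fin; toℕ; fromℕ<)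
open import Data.Fin.Properties using (toℕ<n; toℕ-fromℕ<; fromℕ<-toℕ)
open import Data.List.Base using (tabulate)
open import Data.List.Properties using (map-tabulate)
open import Data.Nat.ListAction using (sum)
open import Data.Product.Base using (_×_; _,_; proj₁; proj₂)
open import Data.Sum.Base using (_⊎_; inj₁; inj₂)
open import Data.Empty using (⊥; ⊥-elim)
open import Relation.Nullary using (¬_; Dec; yes; no)
open import Relation.Binary.PropositionalEquality
open import Relation.Binary.Definitions using (tri<; tri≈; tri>)
open import Function.Base using (_∘_)

∧-elimˡ : ∀ {a b} → a ∧ b ≡ true → a ≡ true
∧-elimˡ {true} _ = refl

∧-elimʳ : ∀ {a b} → a ∧ b ≡ true → b ≡ true
∧-elimʳ {true} p = p

∧-intro : ∀ {a b} → a ≡ true → b ≡ true → a ∧ b ≡ true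
∧-intro refl refl = refl

∨-elim : ∀ {a b} → a ∨ b ≡ true → a ≡ true ⊎ b ≡ true
∨-elim {true} _ = inj₁ refl
∨-elim {false} p = inj₂ p

∨-introˡ : ∀ {a b} → a ≡ true → a ∨ b ≡ true
∨-introˡ refl = refl

∨-introʳ : ∀ {a b} → b ≡ true → a ∨ b ≡ true
∨-introʳ {true} _ = refl
∨-introʳ {false} p = p

true≢false : ∀ {a} → a ≡ true → a ≡ false → ⊥
true≢false refl ()

bool-ext : ∀ {a b} → (a ≡ true → b ≡ true) → (b ≡ true → a ≡ true) → a ≡ b
bool-ext {true} f _ = sym (f refl)
bool-ext {false} {true} _ g = g refl
bool-ext {false} {false} _ _ = refl

_==_ : Bool → Bool → Bool
true == b = b
false == b = not b

==-refl : ∀ a → (a == a) ≡ true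
==-refl true = refl
==-refl false = refl

==-sym : ∀ a b → (a == b) ≡ true → (b == a) ≡ true
==-sym true true _ = refl
==-sym false false _ = refl

==-trans : ∀ a b c → (a == b) ≡ true → (b == c) ≡ true → (a == c) ≡ true
==-trans true true true _ _ = refl
==-trans false false false _ _ = refl

==⇒≡ : ∀ a b → (a == b) ≡ true → a ≡ b
==⇒≡ true true _ = refl
==⇒≡ false false _ = refl

≡⇒== : ∀ a b → a ≡ b → (a == b) ≡ true
≡⇒== a .a refl = ==-refl a

not-==-not : ∀ a b → (not a == not b) ≡ (a == b)
not-==-not true true = refl
not-==-not true false = refl
not-==-not false true = refl
not-==-not false false = refl

<⇒<ᵇ≡true : ∀ {i N} → i < N → (i <ᵇ N) ≡ true
<⇒<ᵇ≡true {zero} {suc N} _ = refl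
<⇒<ᵇ≡true {suc i} {suc N} (s≤s p) = <⇒<ᵇ≡true p

≥⇒<ᵇ≡false : ∀ {i N} → N ≤ i → (i <ᵇ N) ≡ false
≥⇒<ᵇ≡false {i} {zero} _ = refl
≥⇒<ᵇ≡false {suc i} {suc N} (s≤s p) = ≥⇒<ᵇ≡false p

<ᵇ≡true⇒< : ∀ {i N} → (i <ᵇ N) ≡ true → i < N
<ᵇ≡true⇒< {zero} {suc N} _ = s≤s z≤n
<ᵇ≡true⇒< {suc i} {suc N} p = s≤s (<ᵇ≡true⇒< p)

+-<ᵇ-+ : ∀ y c h → (y + h <ᵇ c + h) ≡ (y <ᵇ c)
+-<ᵇ-+ y c zero rewrite +-identityʳ y | +-identityʳ c = refl
+-<ᵇ-+ y c (suc h) rewrite +-suc y h | +-suc c h = +-<ᵇ-+ y c h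

indicator : Bool → ℕ
indicator b = if b then 1 else 0

Σ< : ℕ → (ℕ → ℕ) → ℕ
Σ< zero f = 0
Σ< (suc n) f = f 0 + Σ< n (λ i → f (suc i))

count : ℕ → (ℕ → Bool) → ℕ
count N P = Σ< N (λ i → indicator (P i))

Σ<-cong : ∀ n {f g : ℕ → ℕ} → (∀ i → i < n → f i ≡ g i) → Σ< n f ≡ Σ< n g
Σ<-cong zero h = refl
Σ<-cong (suc n) h = cong₂ _+_ (h 0 (s≤s z≤n)) (Σ<-cong n (λ i p → h (suc i) (s≤s p)))

Σ<-+ : ∀ n (f g : ℕ → ℕ) → Σ< n (λ i → f i + g i) ≡ Σ< n f + Σ< n g
Σ<-+ zero f g = refl
Σ<-+ (suc n) f g = trans (cong (f 0 + g 0 +_) (Σ<-+ n (λ i → f (suc i)) (λ i → g (suc i))))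
                         (+-interchange (f 0) (g 0) _ _)

Σ<-zero : ∀ n (f : ℕ → ℕ) → (∀ i → i < n → f i ≡ 0) → Σ< n f ≡ 0
Σ<-zero zero f h = refl
Σ<-zero (suc n) f h rewrite h 0 (s≤s z≤n) = Σ<-zero n (λ i → f (suc i)) (λ i p → h (suc i) (s≤s p))

Σ<-swap : ∀ n m (h : ℕ → ℕ → ℕ) → Σ< n (λ i → Σ< m (h i)) ≡ Σ< m (λ j → Σ< n (λ i → h i j))
Σ<-swap zero m h = sym (Σ<-zero m (λ _ → 0) (λ _ _ → refl))
Σ<-swap (suc n) m h rewrite Σ<-swap n m (λ i → h (suc i)) =
  sym (Σ<-+ m (h 0) (λ j → Σ< n (λ i → h (suc i) j)))

Σ<-split : ∀ m n (f : ℕ → ℕ) → Σ< (m + n) f ≡ Σ< m f + Σ< n (λ i → f (m + i))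
Σ<-split zero n f = refl
Σ<-split (suc m) n f rewrite Σ<-split m n (λ i → f (suc i)) = sym (+-assoc (f 0) _ _)

Σ<-indicator-≡ᵇ : ∀ n a → a < n → Σ< n (λ j → indicator (a ≡ᵇ j)) ≡ 1
Σ<-indicator-≡ᵇ (suc n) zero _ = cong suc (Σ<-zero n _ (λ _ _ → refl))
Σ<-indicator-≡ᵇ (suc n) (suc a) (s≤s p) = Σ<-indicator-≡ᵇ n a p

Σ<-∣ : ∀ n d (f : ℕ → ℕ) → (∀ i → i < n → d ∣ f i) → d ∣ Σ< n f
Σ<-∣ zero d f h = d ∣0
Σ<-∣ (suc n) d f h =
  ∣m∣n⇒∣m+n (h 0 (s≤s z≤n)) (Σ<-∣ n d (λ i → f (suc i)) (λ i p → h (suc i) (s≤s p)))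

count-true : ∀ N → count N (λ _ → true) ≡ N
count-true zero = refl
count-true (suc N) = cong suc (count-true N)

count-∧-not : ∀ N (P Q : ℕ → Bool) →
  count N P ≡ count N (λ x → P x ∧ Q x) + count N (λ x → P x ∧ not (Q x))
count-∧-not N P Q =
  trans (Σ<-cong N (λ x _ → cell (P x) (Q x)))
        (Σ<-+ N (λ x → indicator (P x ∧ Q x)) (λ x → indicator (P x ∧ not (Q x))))
  where
  cell : ∀ a b → indicator a ≡ indicator (a ∧ b) + indicator (a ∧ not b)
  cell true true = refl
  cell true false = refl
  cell false b = refl

-- The least i < n with p i, and n if there is none.
first : (ℕ → Bool) → ℕ → ℕ
first p zero = zero
first p (suc n) with p 0
... | true = 0
... | false = suc (first (λ i → p (suc i)) n)

first-minimal : ∀ p n j → p j ≡ true → j < n → p (first p n) ≡ true × first p n ≤ j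
first-minimal p (suc n) j pj jn with p 0 in eq
... | true = eq , z≤n
first-minimal p (suc n) zero pj jn | false = ⊥-elim (true≢false pj eq)
first-minimal p (suc n) (suc j) pj (s≤s jn) | false =
  let r = first-minimal (λ i → p (suc i)) n j pj jn in proj₁ r , s≤s (proj₂ r)

first-<⇒satisfies : ∀ p n → first p n < n → p (first p n) ≡ true
first-<⇒satisfies p (suc n) lt with p 0 in eq
... | true = eq
... | false = first-<⇒satisfies (λ i → p (suc i)) n (≤-pred lt)

first-cong : ∀ p q n → (∀ i → p i ≡ q i) → first p n ≡ first q n
first-cong p q zero h = refl
first-cong p q (suc n) h rewrite h 0 with q 0
... | true = refl
... | false = cong suc (first-cong (λ i → p (suc i)) (λ i → q (suc i)) n (λ i → h (suc i)))

≡ᵇ-true⇒≡ : ∀ m n → (m ≡ᵇ n) ≡ true → m ≡ n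
≡ᵇ-true⇒≡ zero zero _ = refl
≡ᵇ-true⇒≡ (suc m) (suc n) p = cong suc (≡ᵇ-true⇒≡ m n p)

≡⇒≡ᵇ-true : ∀ {m n} → m ≡ n → (m ≡ᵇ n) ≡ true
≡⇒≡ᵇ-true {zero} refl = refl
≡⇒≡ᵇ-true {suc m} refl = ≡⇒≡ᵇ-true {m} refl

-- Boolean relations on [N]

-- A partition of [N] is handled through its block relation on ℕ, false outside [N].
BoolRel : Set
BoolRel = ℕ → ℕ → Bool

_≗₂_ : BoolRel → BoolRel → Set
X ≗₂ Y = ∀ i j → X i j ≡ Y i j

_⊆₂_ : BoolRel → BoolRel → Set
X ⊆₂ Y = ∀ i j → X i j ≡ true → Y i j ≡ true

record IsEquivalenceOn (N : ℕ) (R : BoolRel) : Set where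
  field
    ∼-bounded : ∀ {i j} → R i j ≡ true → i < N × j < N
    ∼-refl : ∀ {i} → i < N → R i i ≡ true
    ∼-sym : ∀ {i j} → R i j ≡ true → R j i ≡ true
    ∼-trans : ∀ {i j l} → R i j ≡ true → R j l ≡ true → R i l ≡ true

Noncrossing : BoolRel → Set
Noncrossing R = ∀ {a b c d} → a < b → b < c → c < d →
  R a c ≡ true → R b d ≡ true → R a b ≡ false → ⊥

Noncrossing-≗ : ∀ {X Y} → X ≗₂ Y → Noncrossing X → Noncrossing Y
Noncrossing-≗ X≗Y nc ab bc cd ac bd ab′ =
  nc ab bc cd (trans (X≗Y _ _) ac) (trans (X≗Y _ _) bd) (trans (X≗Y _ _) ab′)

module _ {N : ℕ} {R : BoolRel} (E : IsEquivalenceOn N R) where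
  open IsEquivalenceOn E

  ∼-row : ∀ {i j} → R i j ≡ true → ∀ x → R i x ≡ R j x
  ∼-row rij x = bool-ext (∼-trans (∼-sym rij)) (∼-trans rij)

  blockMin : ℕ → ℕ
  blockMin i = first (R i) N

  blockMin-∼ : ∀ {i} → i < N → R i (blockMin i) ≡ true
  blockMin-∼ {i} iN = proj₁ (first-minimal (R i) N i (∼-refl iN) iN)

  blockMin-< : ∀ {i} → i < N → blockMin i < N
  blockMin-< {i} iN = ≤-<-trans (proj₂ (first-minimal (R i) N i (∼-refl iN) iN)) iN

  blockMin-cong : ∀ {i j} → R i j ≡ true → blockMin i ≡ blockMin j
  blockMin-cong rij = first-cong _ _ N (∼-row rij)

  -- Double counting: every element is counted once, in the column of the least element of its block.
  count-blockUnion-∣ : ∀ d (P : ℕ → Bool) → (∀ {i j} → R i j ≡ true → P i ≡ P j) →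
    (∀ j → j < N → P j ≡ true → d ∣ count N (R j)) → d ∣ count N P
  count-blockUnion-∣ d P closed blocks-∣ = subst (d ∣_) (sym by-blockMin) (Σ<-∣ N d column column-∣)
    where
    cell : ℕ → ℕ → ℕ
    cell i j = indicator (P i ∧ (blockMin i ≡ᵇ j))

    column : ℕ → ℕ
    column j = Σ< N (λ i → cell i j)

    row : ∀ i → i < N → indicator (P i) ≡ Σ< N (cell i)
    row i iN with P i
    ... | true = sym (Σ<-indicator-≡ᵇ N (blockMin i) (blockMin-< iN))
    ... | false = sym (Σ<-zero N _ (λ _ _ → refl))

    by-blockMin : count N P ≡ Σ< N column
    by-blockMin = trans (Σ<-cong N row) (Σ<-swap N N cell)

    member : ∀ {i j} → i < N → (P i ∧ (blockMin i ≡ᵇ j)) ≡ true → R i j ≡ true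
    member {i} iN h = subst (λ z → R i z ≡ true) (≡ᵇ-true⇒≡ _ _ (∧-elimʳ {P i} h)) (blockMin-∼ iN)

    column-∣ : ∀ j → j < N → d ∣ column j
    column-∣ j jN with P j ∧ (blockMin j ≡ᵇ j) in isLeader
    ... | true = subst (d ∣_) (Σ<-cong N λ i iN → cong indicator (sym (inBlock iN)))
                       (blocks-∣ j jN (∧-elimˡ isLeader))
      where
      inBlock : ∀ {i} → i < N → (P i ∧ (blockMin i ≡ᵇ j)) ≡ R j i
      inBlock iN = bool-ext (λ h → ∼-sym (member iN h))
        (λ rji → ∧-intro (trans (closed (∼-sym rji)) (∧-elimˡ isLeader))
                         (≡⇒≡ᵇ-true (trans (blockMin-cong (∼-sym rji))
                           (≡ᵇ-true⇒≡ _ _ (∧-elimʳ {P j} isLeader)))))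
    ... | false = subst (d ∣_) (sym (Σ<-zero N _ λ i iN → cong indicator (notInColumn iN))) (d ∣0)
      where
      notInColumn : ∀ {i} → i < N → (P i ∧ (blockMin i ≡ᵇ j)) ≡ false
      notInColumn {i} iN = ¬-not λ h → true≢false
        (∧-intro (trans (sym (closed (member iN h))) (∧-elimˡ h))
                 (subst (λ z → (z ≡ᵇ j) ≡ true) (blockMin-cong (member iN h)) (∧-elimʳ {P i} h)))
        isLeader

interval : ℕ → ℕ → ℕ → Bool
interval u v i = not (i <ᵇ u) ∧ (i <ᵇ v)

interval-true : ∀ {u v i} → interval u v i ≡ true → u ≤ i × i < v
interval-true {u} {v} {i} p with i <? u
... | yes iu rewrite <⇒<ᵇ≡true iu = ⊥-elim (true≢false p refl)
... | no i≮u rewrite ≥⇒<ᵇ≡false (≮⇒≥ i≮u) = ≮⇒≥ i≮u , <ᵇ≡true⇒< p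

interval-false : ∀ {u v i} → interval u v i ≡ false → i < u ⊎ v ≤ i
interval-false {u} {v} {i} p with i <? u | i <? v
... | yes iu | _ = inj₁ iu
... | no _ | no i≮v = inj₂ (≮⇒≥ i≮v)
... | no i≮u | yes iv rewrite ≥⇒<ᵇ≡false (≮⇒≥ i≮u) | <⇒<ᵇ≡true iv = ⊥-elim (true≢false refl p)

module _ {N : ℕ} {R : BoolRel} (E : IsEquivalenceOn N R) (nc : Noncrossing R) where
  open IsEquivalenceOn E

  -- A block other than that of u, v cannot cross it, so it lies inside [u, v) or outside it.
  interval-blockwise : ∀ {u v i j} → R u v ≡ true → R i j ≡ true → R u i ≡ false →
    interval u v i ≡ interval u v j
  interval-blockwise {u} {v} {i} {j} uv ij ui = bool-ext (inside ij ui) (inside (∼-sym ij) uj)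
    where
    uj : R u j ≡ false
    uj = ¬-not λ p → true≢false (∼-trans p (∼-sym ij)) ui
    inside : ∀ {x y} → R x y ≡ true → R u x ≡ false → interval u v x ≡ true → interval u v y ≡ true
    inside {x} {y} xy ux x∈ = ¬-not λ y∉ → outside (interval-false y∉)
      where
      uy : R u y ≡ false
      uy = ¬-not λ p → true≢false (∼-trans p (∼-sym xy)) ux
      ux<v = interval-true x∈
      u<x : u < x
      u<x = ≤∧≢⇒< (proj₁ ux<v) λ e → true≢false (subst (λ z → R u z ≡ true) e (∼-refl (proj₁ (∼-bounded uv)))) ux
      outside : y < u ⊎ v ≤ y → ⊥
      outside (inj₁ yu) = nc yu u<x (proj₂ ux<v) (∼-sym xy) uv (¬-not λ p → true≢false (∼-sym p) uy)
      outside (inj₂ vy) = nc u<x (proj₂ ux<v)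
        (≤∧≢⇒< vy λ e → true≢false (subst (λ z → R u z ≡ true) e uv) uy) uv xy ux

-- Opaque so that implicit arguments of the lemmas below are not lost by unfolding.
opaque
  within : ℕ → BoolRel → BoolRel
  within N X i j = (i <ᵇ N) ∧ ((j <ᵇ N) ∧ X i j)

  within-bounded : ∀ {N X i j} → within N X i j ≡ true → i < N × j < N
  within-bounded {N} {i = i} p = <ᵇ≡true⇒< (∧-elimˡ p) , <ᵇ≡true⇒< (∧-elimˡ (∧-elimʳ {i <ᵇ N} p))

  within-inner : ∀ {N X i j} → within N X i j ≡ true → X i j ≡ true
  within-inner {N} {i = i} {j} p = ∧-elimʳ {j <ᵇ N} (∧-elimʳ {i <ᵇ N} p)

  within-≡ : ∀ {N X i j} → i < N → j < N → within N X i j ≡ X i j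
  within-≡ iN jN rewrite <⇒<ᵇ≡true iN | <⇒<ᵇ≡true jN = refl

within-intro : ∀ {N X i j} → i < N → j < N → X i j ≡ true → within N X i j ≡ true
within-intro iN jN p = trans (within-≡ iN jN) p

within-outside : ∀ {N X i j} → ¬ (i < N × j < N) → within N X i j ≡ false
within-outside {N} {X} {i} {j} out = ¬-not λ p → out (within-bounded p)

within-cong : ∀ {N X Y i j} → (i < N → j < N → X i j ≡ Y i j) → within N X i j ≡ within N Y i j
within-cong {N} {i = i} {j} h with i <? N | j <? N
... | yes iN | yes jN = trans (within-≡ iN jN) (trans (h iN jN) (sym (within-≡ iN jN)))
... | no iN | _ = trans (within-outside (iN ∘ proj₁)) (sym (within-outside (iN ∘ proj₁)))
... | yes _ | no jN = trans (within-outside (jN ∘ proj₂)) (sym (within-outside (jN ∘ proj₂)))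

within-exact : ∀ {N X R i j} → IsEquivalenceOn N R → (i < N → j < N → X i j ≡ R i j) →
  within N X i j ≡ R i j
within-exact {N} {i = i} {j} E h with i <? N | j <? N
... | yes iN | yes jN = trans (within-≡ iN jN) (h iN jN)
... | no iN | _ = trans (within-outside (iN ∘ proj₁)) (sym (¬-not (iN ∘ proj₁ ∘ ∼-bounded)))
  where open IsEquivalenceOn E
... | yes _ | no jN = trans (within-outside (jN ∘ proj₂)) (sym (¬-not (jN ∘ proj₂ ∘ ∼-bounded)))
  where open IsEquivalenceOn E

within-isEquivalence : ∀ {N X} → (∀ {i} → i < N → X i i ≡ true) →
  (∀ {i j} → i < N → j < N → X i j ≡ true → X j i ≡ true) →
  (∀ {i j l} → i < N → j < N → l < N → X i j ≡ true → X j l ≡ true → X i l ≡ true) →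
  IsEquivalenceOn N (within N X)
within-isEquivalence {N} {X} r s t = record
  { ∼-bounded = within-bounded
  ; ∼-refl = λ iN → within-intro iN iN (r iN)
  ; ∼-sym = λ p → let (iN , jN) = within-bounded p in within-intro jN iN (s iN jN (within-inner p))
  ; ∼-trans = λ p q → let (iN , jN) = within-bounded p ; (_ , lN) = within-bounded q in
      within-intro iN lN (t iN jN lN (within-inner p) (within-inner q))
  }

[m%n+o]%n≡[m+o]%n : ∀ a b N .{{_ : NonZero N}} → ((a % N) + b) % N ≡ (a + b) % N
[m%n+o]%n≡[m+o]%n a b N = begin
  ((a % N) + b) % N         ≡⟨ %-distribˡ-+ (a % N) b N ⟩
  ((a % N % N) + b % N) % N ≡⟨ cong (λ z → (z + b % N) % N) (m%n%n≡m%n a N) ⟩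
  ((a % N) + b % N) % N     ≡⟨ %-distribˡ-+ a b N ⟨
  (a + b) % N               ∎
  where open ≡-Reasoning

module _ {N : ℕ} .{{_ : NonZero N}} where

  rotate : ℕ → BoolRel → BoolRel
  rotate r R = within N (λ i j → R ((i + r) % N) ((j + r) % N))

  rotate-≡ : ∀ {r R i j} → i < N → j < N → rotate r R i j ≡ R ((i + r) % N) ((j + r) % N)
  rotate-≡ = within-≡

  rotate-isEquivalence : ∀ {R} r → IsEquivalenceOn N R → IsEquivalenceOn N (rotate r R)
  rotate-isEquivalence r E = within-isEquivalence
    (λ _ → ∼-refl (m%n<n _ N)) (λ _ _ → ∼-sym) (λ _ _ _ → ∼-trans)
    where open IsEquivalenceOn E

  rotate-rotate : ∀ r s R → rotate r (rotate s R) ≗₂ rotate (r + s) R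
  rotate-rotate r s R i j = within-cong λ iN jN →
    trans (rotate-≡ {s} {R} (m%n<n (i + r) N) (m%n<n (j + r) N)) (cong₂ R (shift-shift i) (shift-shift j))
    where
    shift-shift : ∀ x → ((x + r) % N + s) % N ≡ (x + (r + s)) % N
    shift-shift x = trans ([m%n+o]%n≡[m+o]%n (x + r) s N) (cong (_% N) (+-assoc x r s))

  rotate-by-multiple : ∀ {R} → IsEquivalenceOn N R → ∀ t → rotate (t * N) R ≗₂ R
  rotate-by-multiple {R} E t i j = within-exact E λ iN jN → cong₂ R (back iN) (back jN)
    where
    back : ∀ {x} → x < N → (x + t * N) % N ≡ x
    back {x} xN = trans ([m+kn]%n≡m%n x t N) (m<n⇒m%n≡m xN)

  private
    suc-mod : ∀ {x} → suc x < N → (x + 1) % N ≡ suc x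
    suc-mod {x} p = trans (cong (_% N) (+-comm x 1)) (m<n⇒m%n≡m p)

    suc-mod-last : ∀ {x} → suc x ≡ N → (x + 1) % N ≡ 0
    suc-mod-last {x} p = trans (cong (_% N) (trans (+-comm x 1) p)) (n%n≡0 N)

  -- After a rotation by one step only d can wrap around, to 0; then 0 < a+1 < b+1 < c+1 is a crossing.
  rotate-one-noncrossing : ∀ {R} → IsEquivalenceOn N R → Noncrossing R → Noncrossing (rotate 1 R)
  rotate-one-noncrossing {R} E nc {a} {b} {c} {d} ab bc cd ac bd ab′ = cases (suc d <? N)
    where
    open IsEquivalenceOn E
    dN = proj₂ (within-bounded bd)
    scN : suc c < N
    scN = ≤-trans (s≤s cd) dN
    sbN = <-trans (s≤s bc) scN
    saN = <-trans (s≤s ab) sbN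
    R-true : ∀ {x y u v} → rotate 1 R x y ≡ true → (x + 1) % N ≡ u → (y + 1) % N ≡ v → R u v ≡ true
    R-true p eu ev = subst₂ (λ u v → R u v ≡ true) eu ev (within-inner p)
    ac′ : R (suc a) (suc c) ≡ true
    ac′ = R-true ac (suc-mod saN) (suc-mod scN)
    ab″ : R (suc a) (suc b) ≡ false
    ab″ = trans (sym (trans (rotate-≡ {1} {R} (<-trans (n<1+n a) saN) (<-trans (n<1+n b) sbN))
                            (cong₂ R (suc-mod saN) (suc-mod sbN)))) ab′
    cases : Dec (suc d < N) → ⊥
    cases (yes sdN) = nc (s≤s ab) (s≤s bc) (s≤s cd) ac′ (R-true bd (suc-mod sbN) (suc-mod sdN)) ab″
    cases (no sd≮N) = nc (s≤s z≤n) (s≤s ab) (s≤s bc) (∼-sym bd′) ac′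
      (¬-not λ r → true≢false (∼-sym (∼-trans bd′ r)) ab″)
      where
      bd′ : R (suc b) 0 ≡ true
      bd′ = R-true bd (suc-mod sbN) (suc-mod-last (≤-antisym dN (≮⇒≥ sd≮N)))

  rotate-noncrossing : ∀ {R} → IsEquivalenceOn N R → Noncrossing R → ∀ r → Noncrossing (rotate r R)
  rotate-noncrossing E nc zero = Noncrossing-≗ (λ i j → sym (rotate-by-multiple E 0 i j)) nc
  rotate-noncrossing {R} E nc (suc r) = Noncrossing-≗ (rotate-rotate 1 r R)
    (rotate-one-noncrossing (rotate-isEquivalence r E) (rotate-noncrossing E nc r))

  rotate-back : ∀ {R c} → IsEquivalenceOn N R → c ≤ N → rotate (N ∸ c) (rotate c R) ≗₂ R
  rotate-back {R} {c} E c≤N i j = begin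
    rotate (N ∸ c) (rotate c R) i j ≡⟨ rotate-rotate (N ∸ c) c R i j ⟩
    rotate (N ∸ c + c) R i j        ≡⟨ cong (λ t → rotate t R i j) (trans (m∸n+n≡m c≤N) (sym (*-identityˡ N))) ⟩
    rotate (1 * N) R i j            ≡⟨ rotate-by-multiple E 1 i j ⟩
    R i j                           ∎
    where open ≡-Reasoning

-- Partitions of Fin N

module _ {N : ℕ} where

  toBoolRel : Partition N → BoolRel
  toBoolRel π i j with i <? N | j <? N
  ... | yes iN | yes jN = rel π (fromℕ< iN) (fromℕ< jN)
  ... | _ | _ = false

  toBoolRel-fromℕ< : ∀ (π : Partition N) {i j} (iN : i < N) (jN : j < N) →
    toBoolRel π i j ≡ rel π (fromℕ< iN) (fromℕ< jN)
  toBoolRel-fromℕ< π {i} {j} iN jN with i <? N | j <? N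
  ... | yes _ | yes _ = refl
  ... | no i≮N | _ = ⊥-elim (i≮N iN)
  ... | yes _ | no j≮N = ⊥-elim (j≮N jN)

  toBoolRel-bounded : ∀ (π : Partition N) {i j} → toBoolRel π i j ≡ true → i < N × j < N
  toBoolRel-bounded π {i} {j} e with i <? N | j <? N
  ... | yes iN | yes jN = iN , jN

  toBoolRel-toℕ : ∀ (π : Partition N) (a b : Fin N) → toBoolRel π (toℕ a) (toℕ b) ≡ rel π a b
  toBoolRel-toℕ π a b = trans (toBoolRel-fromℕ< π (toℕ<n a) (toℕ<n b))
    (cong₂ (rel π) (fromℕ<-toℕ a (toℕ<n a)) (fromℕ<-toℕ b (toℕ<n b)))

  toBoolRel-isEquivalence : ∀ (π : Partition N) → IsEquivalenceOn N (toBoolRel π)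
  toBoolRel-isEquivalence π = record
    { ∼-bounded = toBoolRel-bounded π
    ; ∼-refl = λ iN → trans (toBoolRel-fromℕ< π iN iN) (rel-refl π _)
    ; ∼-sym = λ e → let (iN , jN) = toBoolRel-bounded π e in
        trans (toBoolRel-fromℕ< π jN iN) (rel-sym π _ _ (trans (sym (toBoolRel-fromℕ< π iN jN)) e))
    ; ∼-trans = λ e e′ → let (iN , jN) = toBoolRel-bounded π e ; (_ , lN) = toBoolRel-bounded π e′ in
        trans (toBoolRel-fromℕ< π iN lN) (rel-trans π _ _ _ (trans (sym (toBoolRel-fromℕ< π iN jN)) e)
                                                           (trans (sym (toBoolRel-fromℕ< π jN lN)) e′))
    }

  toBoolRel-mono : ∀ (π π′ : Partition N) → π ⊑ π′ → toBoolRel π ⊆₂ toBoolRel π′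
  toBoolRel-mono π π′ π⊑π′ i j e = let (iN , jN) = toBoolRel-bounded π e in
    trans (toBoolRel-fromℕ< π′ iN jN) (π⊑π′ _ _ (trans (sym (toBoolRel-fromℕ< π iN jN)) e))

  toBoolRel-noncrossing : ∀ (π : Partition N) → NonCrossing π → Noncrossing (toBoolRel π)
  toBoolRel-noncrossing π ncπ {a} {b} {c} {d} ab bc cd ac bd ab′ =
    ncπ (fromℕ< aN) (fromℕ< bN) (fromℕ< cN) (fromℕ< dN)
      (fromℕ<-mono aN bN ab , fromℕ<-mono bN cN bc , fromℕ<-mono cN dN cd ,
       trans (sym (toBoolRel-fromℕ< π aN cN)) ac , trans (sym (toBoolRel-fromℕ< π bN dN)) bd ,
       λ e → true≢false (trans (toBoolRel-fromℕ< π aN bN) e) ab′)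
    where
    aN = proj₁ (toBoolRel-bounded π ac)
    cN = proj₂ (toBoolRel-bounded π ac)
    bN = proj₁ (toBoolRel-bounded π bd)
    dN = proj₂ (toBoolRel-bounded π bd)
    fromℕ<-mono : ∀ {x y} (xN : x < N) (yN : y < N) → x < y → toℕ (fromℕ< xN) < toℕ (fromℕ< yN)
    fromℕ<-mono xN yN xy = subst₂ _<_ (sym (toℕ-fromℕ< xN)) (sym (toℕ-fromℕ< yN)) xy

  fromBoolRel : (R : BoolRel) → IsEquivalenceOn N R → Partition N
  fromBoolRel R E = record
    { rel = λ a b → R (toℕ a) (toℕ b)
    ; rel-refl = λ a → ∼-refl (toℕ<n a)
    ; rel-sym = λ _ _ → ∼-sym
    ; rel-trans = λ _ _ _ → ∼-trans
    }
    where open IsEquivalenceOn E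

  toBoolRel-fromBoolRel : ∀ (R : BoolRel) (E : IsEquivalenceOn N R) → toBoolRel (fromBoolRel R E) ≗₂ R
  toBoolRel-fromBoolRel R E i j with i <? N | j <? N
  ... | yes iN | yes jN = cong₂ R (toℕ-fromℕ< iN) (toℕ-fromℕ< jN)
  ... | no i≮N | _ = sym (¬-not λ e → i≮N (proj₁ (IsEquivalenceOn.∼-bounded E e)))
  ... | yes _ | no j≮N = sym (¬-not λ e → j≮N (proj₂ (IsEquivalenceOn.∼-bounded E e)))

  fromBoolRel-noncrossing : ∀ (R : BoolRel) (E : IsEquivalenceOn N R) → Noncrossing R → NonCrossing (fromBoolRel R E)
  fromBoolRel-noncrossing R E nc a b c d (ab , bc , cd , ac , bd , ab′) = nc ab bc cd ac bd (¬-not ab′)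

  sum-tabulate : ∀ n (g : Fin n → ℕ) (F : ℕ → ℕ) → (∀ a → g a ≡ F (toℕ a)) → sum (tabulate g) ≡ Σ< n F
  sum-tabulate zero g F h = refl
  sum-tabulate (suc n) g F h = cong₂ _+_ (h Fin.zero) (sum-tabulate n (λ a → g (Fin.suc a)) (λ i → F (suc i)) (λ a → h (Fin.suc a)))
    where import Data.Fin.Base as Fin

  blockSize-≡-count : ∀ (π : Partition N) (R : BoolRel) → (∀ a b → rel π a b ≡ R (toℕ a) (toℕ b)) →
    ∀ i → blockSize π i ≡ count N (R (toℕ i))
  blockSize-≡-count π R π≡R i = trans (cong sum (map-tabulate {n = N} (λ x → x) (λ j → indicator (rel π i j))))
    (sum-tabulate N (λ j → indicator (rel π i j)) (λ y → indicator (R (toℕ i) y)) λ a → cong indicator (π≡R i a))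

≡-rel⇒⊑× : ∀ {N} (π π′ : Partition N) → (∀ a b → rel π a b ≡ rel π′ a b) → π ⊑ π′ × π′ ⊑ π
≡-rel⇒⊑× π π′ π≡π′ = (λ a b p → trans (sym (π≡π′ a b)) p) , (λ a b p → trans (π≡π′ a b) p)

-- The two halves of [2H]

module Halves (H′ : ℕ) where

  H : ℕ
  H = suc H′

  M : ℕ
  M = H + H

  residue : ℕ → ℕ
  residue i = i % H

  lower : ℕ → Bool
  lower i = i <ᵇ H

  ρ : ℕ → ℕ
  ρ i = (i + H) % M

  <H⇒<M : ∀ {x} → x < H → x < M
  <H⇒<M xH = <-≤-trans xH (m≤m+n H H)

  +H<M : ∀ {x} → x < H → x + H < M
  +H<M xH = +-monoˡ-< H xH

  data HalfView : ℕ → Set where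
    lowerHalf : ∀ {x} → x < H → HalfView x
    upperHalf : ∀ {x} → x < H → HalfView (x + H)

  halfView : ∀ {i} → i < M → HalfView i
  halfView {i} iM with i <? H
  ... | yes iH = lowerHalf iH
  ... | no i≮H = subst HalfView (m∸n+n≡m H≤i) (upperHalf (+-cancelʳ-< H (i ∸ H) H i∸H+H<M))
    where
    H≤i = ≮⇒≥ i≮H
    i∸H+H<M : i ∸ H + H < H + H
    i∸H+H<M = subst (_< M) (sym (m∸n+n≡m H≤i)) iM

  residue-< : ∀ x → residue x < H
  residue-< x = m%n<n x H

  residue-lower : ∀ {x} → x < H → residue x ≡ x
  residue-lower = m<n⇒m%n≡m

  residue-upper : ∀ {x} → x < H → residue (x + H) ≡ x
  residue-upper {x} xH = trans ([m+n]%n≡m%n x H) (m<n⇒m%n≡m xH)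

  residue-mono-lower : ∀ {x y} → x < y → y < H → residue x < residue y
  residue-mono-lower {x} {y} xy yH rewrite residue-lower (<-trans xy yH) | residue-lower yH = xy

  residue-mono-upper : ∀ {x y} → H ≤ x → x < y → y < M → residue x < residue y
  residue-mono-upper {x} {y} Hx xy yM with halfView (<-trans xy yM) | halfView yM
  ... | lowerHalf xH | _ = ⊥-elim (<⇒≱ xH Hx)
  ... | upperHalf {x′} x′H | lowerHalf yH = ⊥-elim (<⇒≱ (<-trans xy yH) (m≤n+m H x′))
  ... | upperHalf {x′} x′H | upperHalf {y′} y′H rewrite residue-upper x′H | residue-upper y′H =
    +-cancelʳ-< H x′ y′ xy

  residue-mod-M : ∀ x → residue (x % M) ≡ residue x
  residue-mod-M x = m∣n⇒o%n%m≡o%m H M x (divides 2 (cong (H +_) (sym (+-identityʳ H))))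

  lower-<H : ∀ {x} → x < H → lower x ≡ true
  lower-<H = <⇒<ᵇ≡true

  ρ-lower : ∀ {x} → x < H → ρ x ≡ x + H
  ρ-lower xH = m<n⇒m%n≡m (+H<M xH)

  ρ-upper : ∀ {x} → x < H → ρ (x + H) ≡ x
  ρ-upper {x} xH = trans (cong (_% M) (+-assoc x H H)) (trans ([m+n]%n≡m%n x M) (m<n⇒m%n≡m (<H⇒<M xH)))

  ρ-< : ∀ i → ρ i < M
  ρ-< i = m%n<n (i + H) M

  ρ-involutive : ∀ {i} → i < M → ρ (ρ i) ≡ i
  ρ-involutive iM with halfView iM
  ... | lowerHalf xH rewrite ρ-lower xH = ρ-upper xH
  ... | upperHalf xH rewrite ρ-upper xH = ρ-lower xH

  residue-ρ : ∀ i → residue (ρ i) ≡ residue i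
  residue-ρ i = trans (residue-mod-M (i + H)) ([m+n]%n≡m%n i H)

  -- Each block B of T on [H] is copied to both halves of [M]; the copies are merged for the block of 0.
  double : BoolRel → BoolRel
  double T = within M (λ i j → T (residue i) (residue j) ∧ (T 0 (residue i) ∨ (lower i == lower j)))

  module _ {T : BoolRel} (E : IsEquivalenceOn H T) (nc : Noncrossing T) where
    open IsEquivalenceOn E

    private
      linked : ℕ → ℕ → Bool
      linked i j = T 0 (residue i) ∨ (lower i == lower j)

      residues-∼ : ∀ {i j} → double T i j ≡ true → T (residue i) (residue j) ≡ true
      residues-∼ p = ∧-elimˡ (within-inner p)

      same-half : ∀ {i j} → double T i j ≡ true → T 0 (residue i) ≡ false → lower i ≡ lower j
      same-half {i} {j} p t0 with within-inner p
      ... | q rewrite t0 = ==⇒≡ (lower i) (lower j) (∧-elimʳ {T (residue i) (residue j)} q)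

      not-linked : ∀ {i j} → i < M → j < M → double T i j ≡ false →
        T (residue i) (residue j) ≡ true → linked i j ≡ false
      not-linked {i} {j} iM jM p t = trans (sym (cong (_∧ linked i j) t)) (trans (sym (within-≡ iM jM)) p)

      unrelated-in-half : ∀ {i j} → i < M → j < M → double T i j ≡ false →
        lower i ≡ lower j → T (residue i) (residue j) ≡ false
      unrelated-in-half {i} {j} iM jM p e = ¬-not λ t →
        true≢false (∨-introʳ {T 0 (residue i)} (≡⇒== _ _ e)) (not-linked iM jM p t)

      residue-pos : ∀ {x} → T 0 (residue x) ≡ false → 0 < residue x
      residue-pos {x} t0 = n≢0⇒n>0 λ e → true≢false (subst (λ z → T 0 z ≡ true) (sym e) (∼-refl (s≤s z≤n))) t0

      -- The pair of a, b that is not linked to 0 stays in one half, where it crosses the block of 0.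
      straddling : ∀ {a b c d} → a < b → b < c → c < d → a < H → H ≤ d →
        double T a c ≡ true → double T b d ≡ true → double T a b ≡ false → ⊥
      straddling {a} {b} {c} {d} ab bc cd aH Hd ac bd ab′ = cases (T 0 (residue a)) (T 0 (residue b)) refl refl
        where
        aM = proj₁ (within-bounded ac)
        bM = proj₁ (within-bounded bd)
        cM = proj₂ (within-bounded ac)
        dM = proj₂ (within-bounded bd)
        lower-c : T 0 (residue a) ≡ false → c < H
        lower-c ta = <ᵇ≡true⇒< (trans (sym (same-half ac ta)) (lower-<H aH))
        upper-b : T 0 (residue b) ≡ false → H ≤ b
        upper-b tb = ≮⇒≥ λ bH → true≢false (trans (sym (same-half bd tb)) (lower-<H bH)) (≥⇒<ᵇ≡false Hd)
        cases : ∀ x y → T 0 (residue a) ≡ x → T 0 (residue b) ≡ y → ⊥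
        cases true true ta tb = true≢false (∨-introˡ {T 0 (residue a)} ta)
          (not-linked aM bM ab′ (∼-trans (∼-sym ta) tb))
        cases false false ta tb = <⇒≱ (lower-c ta) (≤-trans (upper-b tb) (<⇒≤ bc))
        cases true false ta tb = nc (residue-pos {b} tb) (residue-mono-upper Hb bc cM)
          (residue-mono-upper (≤-trans Hb (<⇒≤ bc)) cd dM) (∼-trans ta (residues-∼ ac)) (residues-∼ bd) tb
          where Hb = upper-b tb
        cases false true ta tb = nc (residue-pos {a} ta) (residue-mono-lower ab (<-trans bc cH))
          (residue-mono-lower bc cH) tb (residues-∼ ac) ta
          where cH = lower-c ta

    double-noncrossing : Noncrossing (double T)
    double-noncrossing {a} {b} {c} {d} ab bc cd ac bd ab′ with d <? H | H ≤? a
    ... | yes dH | _ = nc (residue-mono-lower ab bH) (residue-mono-lower bc cH) (residue-mono-lower cd dH)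
        (residues-∼ ac) (residues-∼ bd)
        (unrelated-in-half aM bM ab′ (trans (lower-<H (<-trans ab bH)) (sym (lower-<H bH))))
      where
      cH = <-trans cd dH
      bH = <-trans bc cH
      aM = proj₁ (within-bounded ac)
      bM = proj₁ (within-bounded bd)
    ... | no _ | yes Ha = nc (residue-mono-upper Ha ab bM) (residue-mono-upper Hb bc cM)
        (residue-mono-upper (≤-trans Hb (<⇒≤ bc)) cd dM) (residues-∼ ac) (residues-∼ bd)
        (unrelated-in-half aM bM ab′ (trans (≥⇒<ᵇ≡false Ha) (sym (≥⇒<ᵇ≡false Hb))))
      where
      aM = proj₁ (within-bounded ac)
      bM = proj₁ (within-bounded bd)
      cM = proj₂ (within-bounded ac)
      dM = proj₂ (within-bounded bd)
      Hb = ≤-trans Ha (<⇒≤ ab)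
    ... | no d≮H | no H≰a = straddling ab bc cd (≰⇒> H≰a) (≮⇒≥ d≮H) ac bd ab′

  ρ-Invariant : BoolRel → Set
  ρ-Invariant R = ∀ i j → i < M → j < M → R (ρ i) (ρ j) ≡ R i j

  -- Identifies i with ρ i, with [H] as the set of representatives.
  fold : BoolRel → BoolRel
  fold R = within H (λ x y → R x y ∨ R x (y + H))

  fold-≡ : ∀ {R x y} → x < H → y < H → fold R x y ≡ (R x y ∨ R x (y + H))
  fold-≡ = within-≡

  fold-mono : ∀ {R R′} → R ⊆₂ R′ → fold R ⊆₂ fold R′
  fold-mono {R} {R′} R⊆R′ x y p = within-intro xH yH (lift (∨-elim (within-inner p)))
    where
    xH = proj₁ (within-bounded p)
    yH = proj₂ (within-bounded p)
    lift : R x y ≡ true ⊎ R x (y + H) ≡ true → (R′ x y ∨ R′ x (y + H)) ≡ true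
    lift (inj₁ r) = ∨-introˡ (R⊆R′ _ _ r)
    lift (inj₂ r) = ∨-introʳ {R′ x y} (R⊆R′ _ _ r)

  fold-cong : ∀ {R R′} → R ≗₂ R′ → fold R ≗₂ fold R′
  fold-cong {R} {R′} R≗R′ x y = within-cong λ _ _ → cong₂ _∨_ (R≗R′ x y) (R≗R′ x (y + H))

  module Folding {R : BoolRel} (E : IsEquivalenceOn M R) (inv : ρ-Invariant R) where
    open IsEquivalenceOn E

    shift-both : ∀ {x y} → x < H → y < H → R (x + H) (y + H) ≡ R x y
    shift-both {x} {y} xH yH =
      trans (sym (cong₂ R (ρ-lower xH) (ρ-lower yH))) (inv x y (<H⇒<M xH) (<H⇒<M yH))

    shift-left : ∀ {x y} → x < H → y < H → R (x + H) y ≡ R x (y + H)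
    shift-left {x} {y} xH yH =
      trans (sym (cong₂ R (ρ-lower xH) (ρ-upper yH))) (inv x (y + H) (<H⇒<M xH) (+H<M yH))

    fold-isEquivalence : IsEquivalenceOn H (fold R)
    fold-isEquivalence = within-isEquivalence (λ xH → ∨-introˡ (∼-refl (<H⇒<M xH))) fold-sym fold-trans
      where
      fold-sym : ∀ {x y} → x < H → y < H → (R x y ∨ R x (y + H)) ≡ true → (R y x ∨ R y (x + H)) ≡ true
      fold-sym {x} {y} xH yH p with ∨-elim p
      ... | inj₁ r = ∨-introˡ (∼-sym r)
      ... | inj₂ r = ∨-introʳ {R y x} (trans (sym (shift-left yH xH)) (∼-sym r))
      fold-trans : ∀ {x y z} → x < H → y < H → z < H → (R x y ∨ R x (y + H)) ≡ true →
        (R y z ∨ R y (z + H)) ≡ true → (R x z ∨ R x (z + H)) ≡ true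
      fold-trans {x} {y} {z} _ yH zH p q with ∨-elim p | ∨-elim q
      ... | inj₁ r | inj₁ r′ = ∨-introˡ (∼-trans r r′)
      ... | inj₁ r | inj₂ r′ = ∨-introʳ {R x z} (∼-trans r r′)
      ... | inj₂ r | inj₁ r′ = ∨-introʳ {R x z} (∼-trans r (trans (shift-both yH zH) r′))
      ... | inj₂ r | inj₂ r′ = ∨-introˡ (∼-trans r (trans (shift-left yH zH) r′))

    module _ (nc : Noncrossing R) where

      fold-noncrossing : Noncrossing (fold R)
      fold-noncrossing {a} {b} {c} {d} ab bc cd ac bd ab′ = cases (∨-elim (within-inner ac)) (∨-elim (within-inner bd))
        where
        aH = proj₁ (within-bounded ac)
        cH = proj₂ (within-bounded ac)
        bH = proj₁ (within-bounded bd)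
        dH = proj₂ (within-bounded bd)
        unrelated : (R a b ∨ R a (b + H)) ≡ false
        unrelated = trans (sym (fold-≡ {R} aH bH)) ab′
        ab-false : R a b ≡ false
        ab-false = ¬-not λ p → true≢false (∨-introˡ p) unrelated
        ab+H-false : R a (b + H) ≡ false
        ab+H-false = ¬-not λ p → true≢false (∨-introʳ {R a b} p) unrelated
        cases : R a c ≡ true ⊎ R a (c + H) ≡ true → R b d ≡ true ⊎ R b (d + H) ≡ true → ⊥
        cases (inj₁ r) (inj₁ r′) = nc ab bc cd r r′ ab-false
        cases (inj₁ r) (inj₂ r′) = nc ab bc (<-≤-trans cd (m≤m+n d H)) r r′ ab-false
        cases (inj₂ r) (inj₂ r′) = nc ab (<-≤-trans bc (m≤m+n c H)) (+-monoˡ-< H cd) r r′ ab-false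
        cases (inj₂ r) (inj₁ r′) = nc bc cd (<-≤-trans dH (m≤n+m H a)) r′
          (∼-sym (trans (shift-left aH cH) r))
          (¬-not λ rbc → true≢false (∼-trans r (∼-sym (trans (shift-both bH cH) rbc))) ab+H-false)

      -- x ∼ ρ x and y ∼ ρ y, with x < y, would cross unless x ∼ y.
      central-∼ : ∀ {x y} → x < H → y < H → R x (x + H) ≡ true → R y (y + H) ≡ true → R x y ≡ true
      central-∼ {x} {y} xH yH px py with <-cmp x y
      ... | tri≈ _ refl _ = ∼-refl (<H⇒<M xH)
      ... | tri< xy _ _ = ¬-not (nc xy (<-≤-trans yH (m≤n+m H x)) (+-monoˡ-< H xy) px py)
      ... | tri> _ _ yx = ∼-sym (¬-not (nc yx (<-≤-trans xH (m≤n+m H y)) (+-monoˡ-< H yx) py px))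

    fold-count : ∀ {x} → x < H → R x (x + H) ≡ false → count H (fold R x) ≡ count M (R x)
    fold-count {x} xH nx = begin
      count H (fold R x)                                         ≡⟨ Σ<-cong H cell ⟩
      Σ< H (λ y → indicator (R x y) + indicator (R x (H + y)))   ≡⟨ Σ<-+ H (λ y → indicator (R x y)) (λ y → indicator (R x (H + y))) ⟩
      count H (R x) + Σ< H (λ y → indicator (R x (H + y)))       ≡⟨ Σ<-split H H (λ y → indicator (R x y)) ⟨
      count M (R x)                                              ∎
      where
      open ≡-Reasoning
      indicator-∨ : ∀ {a b} → (a ≡ true → b ≡ true → ⊥) → indicator (a ∨ b) ≡ indicator a + indicator b
      indicator-∨ {true} {true} h = ⊥-elim (h refl refl)
      indicator-∨ {true} {false} h = refl
      indicator-∨ {false} h = refl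
      cell : ∀ y → y < H → indicator (fold R x y) ≡ indicator (R x y) + indicator (R x (H + y))
      cell y yH rewrite fold-≡ {R} xH yH | +-comm H y =
        indicator-∨ λ p p′ → true≢false (∼-trans p′ (∼-sym (trans (shift-both xH yH) p))) nx

    fold-residue : ∀ {i j} → i < M → j < M → fold R (residue i) (residue j) ≡ (R i j ∨ R i (ρ j))
    fold-residue iM jM with halfView iM | halfView jM
    ... | lowerHalf {x} xH | lowerHalf {y} yH
      rewrite residue-lower xH | residue-lower yH | fold-≡ {R} xH yH
            | ρ-lower yH = refl
    ... | lowerHalf {x} xH | upperHalf {y} yH
      rewrite residue-lower xH | residue-upper yH | fold-≡ {R} xH yH
            | ρ-upper yH = ∨-comm (R x y) (R x (y + H))
    ... | upperHalf {x} xH | lowerHalf {y} yH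
      rewrite residue-upper xH | residue-lower yH | fold-≡ {R} xH yH
            | ρ-lower yH | shift-both xH yH | shift-left xH yH = ∨-comm (R x y) (R x (y + H))
    ... | upperHalf {x} xH | upperHalf {y} yH
      rewrite residue-upper xH | residue-upper yH | fold-≡ {R} xH yH
            | ρ-upper yH | shift-both xH yH | shift-left xH yH = refl

  sheet : ℕ → ℕ → Bool
  sheet c = interval c (c + H)

  -- The block of c is doubled into one ρ-symmetric block; every other block B is lifted to
  -- the two copies of B inside and outside the sheet [c, c + H).
  unfolded : BoolRel → ℕ → BoolRel
  unfolded S c i j = S (residue i) (residue j) ∧ (S c (residue i) ∨ (sheet c i == sheet c j))

  unfold : BoolRel → ℕ → BoolRel
  unfold S c = within M (unfolded S c)

  unfold-cong : ∀ {S S′} → S ≗₂ S′ → ∀ c → unfold S c ≗₂ unfold S′ c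
  unfold-cong S≗S′ c i j = within-cong λ _ _ →
    cong₂ (λ u v → u ∧ (v ∨ (sheet c i == sheet c j))) (S≗S′ _ _) (S≗S′ _ _)

  mod-below-2M : ∀ x → x < M + M → (x < M × x % M ≡ x) ⊎ (M ≤ x × x % M + M ≡ x)
  mod-below-2M x x<2M with x <? M
  ... | yes xM = inj₁ (xM , m<n⇒m%n≡m xM)
  ... | no x≮M = inj₂ (M≤x , trans (cong (_+ M) x%M≡x∸M) (m∸n+n≡m M≤x))
    where
    M≤x = ≮⇒≥ x≮M
    x∸M<M : x ∸ M < M
    x∸M<M = +-cancelʳ-< M (x ∸ M) M (subst (_< M + M) (sym (m∸n+n≡m M≤x)) x<2M)
    x%M≡x∸M : x % M ≡ x ∸ M
    x%M≡x∸M = trans (sym (m≤n⇒[n∸m]%m≡n%m M≤x)) (m<n⇒m%n≡m x∸M<M)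

  module Unfolding {S : BoolRel} (E : IsEquivalenceOn H S) {c : ℕ} (cH : c < H) where
    open IsEquivalenceOn E

    sheet-lower : ∀ {y} → y < H → sheet c y ≡ not (y <ᵇ c)
    sheet-lower {y} yH rewrite <⇒<ᵇ≡true {y} {c + H} (<-≤-trans yH (m≤n+m H c)) = ∧-identityʳ _

    sheet-upper : ∀ {y} → y < H → sheet c (y + H) ≡ (y <ᵇ c)
    sheet-upper {y} yH rewrite ≥⇒<ᵇ≡false {y + H} {c} (≤-trans (<⇒≤ cH) (m≤n+m H y)) | +-<ᵇ-+ y c H = refl

    sheet-ρ : ∀ {i} → i < M → sheet c (ρ i) ≡ not (sheet c i)
    sheet-ρ iM with halfView iM
    ... | lowerHalf {x} xH rewrite ρ-lower xH | sheet-upper xH | sheet-lower xH = sym (not-involutive _)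
    sheet-ρ iM | upperHalf {x} xH rewrite ρ-upper xH | sheet-upper xH | sheet-lower xH = refl

    sheet-shift : ∀ {i} → i < M → sheet c ((i + c) % M) ≡ lower i
    sheet-shift {i} iM with mod-below-2M (i + c) (+-mono-< iM (<H⇒<M cH))
    ... | inj₁ (_ , e) rewrite e | ≥⇒<ᵇ≡false (m≤n+m c i) | +-comm c H = +-<ᵇ-+ i H c
    ... | inj₂ (M≤i+c , e) = wrapped (wrapped-below-c e) upper
      where
      wrapped-below-c : (i + c) % M + M ≡ i + c → (i + c) % M < c
      wrapped-below-c e = +-cancelʳ-< M _ c
        (subst (_< c + M) (sym e) (subst (i + c <_) (+-comm M c) (+-monoˡ-< c iM)))
      upper : H ≤ i
      upper = ≮⇒≥ λ iH → <⇒≱ (+-mono-< iH cH) M≤i+c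
      wrapped : (i + c) % M < c → H ≤ i → sheet c ((i + c) % M) ≡ lower i
      wrapped p q rewrite <⇒<ᵇ≡true p | ≥⇒<ᵇ≡false q = refl

    private
      U = unfold S c

    unfold-≡ : ∀ {i j} → i < M → j < M → U i j ≡ unfolded S c i j
    unfold-≡ = within-≡

    unfold-isEquivalence : IsEquivalenceOn M U
    unfold-isEquivalence = within-isEquivalence
      (λ {i} _ → ∧-intro (∼-refl (residue-< i)) (∨-introʳ {S c (residue i)} (==-refl (sheet c i))))
      U-sym U-trans
      where
      U-sym : ∀ {i j} → i < M → j < M → unfolded S c i j ≡ true → unfolded S c j i ≡ true
      U-sym {i} {j} _ _ p with ∨-elim (∧-elimʳ {S (residue i) (residue j)} p)
      ... | inj₁ x = ∧-intro (∼-sym (∧-elimˡ p)) (∨-introˡ (∼-trans x (∧-elimˡ p)))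
      ... | inj₂ x = ∧-intro (∼-sym (∧-elimˡ p)) (∨-introʳ {S c (residue j)} (==-sym (sheet c i) _ x))
      U-trans : ∀ {i j l} → i < M → j < M → l < M →
        unfolded S c i j ≡ true → unfolded S c j l ≡ true → unfolded S c i l ≡ true
      U-trans {i} {j} {l} _ _ _ p q
        with ∨-elim (∧-elimʳ {S (residue i) (residue j)} p) | ∨-elim (∧-elimʳ {S (residue j) (residue l)} q)
      ... | inj₁ x | _ = ∧-intro (∼-trans (∧-elimˡ p) (∧-elimˡ q)) (∨-introˡ x)
      ... | inj₂ _ | inj₁ y = ∧-intro (∼-trans (∧-elimˡ p) (∧-elimˡ q)) (∨-introˡ (∼-trans y (∼-sym (∧-elimˡ p))))
      ... | inj₂ x | inj₂ y = ∧-intro (∼-trans (∧-elimˡ p) (∧-elimˡ q))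
                                     (∨-introʳ {S c (residue i)} (==-trans (sheet c i) _ _ x y))

    unfold-invariant : ρ-Invariant U
    unfold-invariant i j iM jM rewrite unfold-≡ (ρ-< i) (ρ-< j) | unfold-≡ iM jM
      | residue-ρ i | residue-ρ j | sheet-ρ iM | sheet-ρ jM | not-==-not (sheet c i) (sheet c j) = refl

    -- The two sheets over a residue y are complementary, so each element of the block of y is counted
    -- once, or twice when y lies in the block of c.
    unfold-count : ∀ {i} → i < M →
      count M (U i) ≡ count H (S (residue i)) + count H (λ y → S (residue i) y ∧ S c (residue i))
    unfold-count {i} iM = begin
      count M (U i)                                                              ≡⟨ Σ<-split H H (λ y → indicator (U i y)) ⟩
      count H (U i) + Σ< H (λ y → indicator (U i (H + y)))                       ≡⟨ Σ<-+ H (λ y → indicator (U i y)) (λ y → indicator (U i (H + y))) ⟨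
      Σ< H (λ y → indicator (U i y) + indicator (U i (H + y)))                   ≡⟨ Σ<-cong H cell ⟩
      Σ< H (λ y → indicator (S (residue i) y) + indicator (S (residue i) y ∧ S c (residue i)))
        ≡⟨ Σ<-+ H (λ y → indicator (S (residue i) y)) (λ y → indicator (S (residue i) y ∧ S c (residue i))) ⟩
      count H (S (residue i)) + count H (λ y → S (residue i) y ∧ S c (residue i)) ∎
      where
      open ≡-Reasoning
      complementary : ∀ a b e f → indicator (a ∧ (b ∨ (e == not f))) + indicator (a ∧ (b ∨ (e == f)))
                                  ≡ indicator a + indicator (a ∧ b)
      complementary true true e f = refl
      complementary true false true true = refl
      complementary true false true false = refl
      complementary true false false true = refl
      complementary true false false false = refl
      complementary false b e f = refl
      cell : ∀ y → y < H → indicator (U i y) + indicator (U i (H + y))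
                            ≡ indicator (S (residue i) y) + indicator (S (residue i) y ∧ S c (residue i))
      cell y yH rewrite unfold-≡ iM (<H⇒<M yH) | unfold-≡ iM (subst (_< M) (+-comm y H) (+H<M yH))
        | residue-lower yH | +-comm H y | residue-upper yH | sheet-upper yH | sheet-lower yH =
        complementary (S (residue i) y) (S c (residue i)) (sheet c i) (y <ᵇ c)

    fold-unfold : fold U ≗₂ S
    fold-unfold x y = within-exact E inner
      where
      covers : ∀ a b e f → ((a ∧ (b ∨ (e == not f))) ∨ (a ∧ (b ∨ (e == f)))) ≡ a
      covers true true e f = refl
      covers true false true true = refl
      covers true false true false = refl
      covers true false false true = refl
      covers true false false false = refl
      covers false b e f = refl
      inner : x < H → y < H → (U x y ∨ U x (y + H)) ≡ S x y
      inner xH yH rewrite unfold-≡ (<H⇒<M xH) (<H⇒<M yH) | unfold-≡ (<H⇒<M xH) (+H<M yH)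
        | residue-lower xH | residue-lower yH | residue-upper yH | sheet-lower yH | sheet-upper yH =
        covers (S x y) (S c x) (sheet c x) (y <ᵇ c)

    -- Rotating by c moves c to 0 and the sheet onto the lower half.
    rotate-unfold : rotate {M} c U ≗₂ double (rotate {H} c S)
    rotate-unfold i j = within-cong inner
      where
      residue-shift : ∀ x → residue ((x + c) % M) ≡ (residue x + c) % H
      residue-shift x = trans (residue-mod-M (x + c)) (sym ([m%n+o]%n≡[m+o]%n x c H))
      inner : i < M → j < M → U ((i + c) % M) ((j + c) % M) ≡
        (rotate c S (residue i) (residue j) ∧ (rotate c S 0 (residue i) ∨ (lower i == lower j)))
      inner iM jM = begin
        U i⁺ j⁺
          ≡⟨ unfold-≡ (m%n<n (i + c) M) (m%n<n (j + c) M) ⟩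
        S (residue i⁺) (residue j⁺) ∧ (S c (residue i⁺) ∨ (sheet c i⁺ == sheet c j⁺))
          ≡⟨ cong₂ (λ u v → S u v ∧ (S c u ∨ (sheet c i⁺ == sheet c j⁺))) (residue-shift i) (residue-shift j) ⟩
        S i′ j′ ∧ (S c i′ ∨ (sheet c i⁺ == sheet c j⁺))
          ≡⟨ cong₂ (λ u v → S i′ j′ ∧ (S u i′ ∨ v)) (sym (m<n⇒m%n≡m cH))
                   (cong₂ _==_ (sheet-shift iM) (sheet-shift jM)) ⟩
        S i′ j′ ∧ (S (c % H) i′ ∨ (lower i == lower j))
          ≡⟨ cong₂ (λ u v → u ∧ (v ∨ (lower i == lower j)))
                   (sym (rotate-≡ {H} {c} {S} (residue-< i) (residue-< j)))
                   (sym (rotate-≡ {H} {c} {S} {0} (s≤s z≤n) (residue-< i))) ⟩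
        rotate c S (residue i) (residue j) ∧ (rotate c S 0 (residue i) ∨ (lower i == lower j)) ∎
        where
        open ≡-Reasoning
        i⁺ = (i + c) % M
        j⁺ = (j + c) % M
        i′ = (residue i + c) % H
        j′ = (residue j + c) % H

    unfold-noncrossing : Noncrossing S → Noncrossing U
    unfold-noncrossing nc = Noncrossing-≗ (rotate-back unfold-isEquivalence (<⇒≤ (<H⇒<M cH)))
      (rotate-noncrossing (rotate-isEquivalence c unfold-isEquivalence) rotated (M ∸ c))
      where
      rotated : Noncrossing (rotate {M} c U)
      rotated = Noncrossing-≗ (λ i j → sym (rotate-unfold i j))
        (double-noncrossing (rotate-isEquivalence c E) (rotate-noncrossing E nc c))

-- The correspondence

module Correspondence (H′ d : ℕ) (d∣M : d ∣ suc H′ + suc H′) (d∤H : ¬ d ∣ suc H′) where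
  open Halves H′

  complement-double-∣ : ∀ {X Y} → X + Y ≡ H → d ∣ Y → d ∣ X + X
  complement-double-∣ {X} {Y} X+Y≡H d∣Y = ∣m+n∣m⇒∣n (subst (d ∣_) M≡ d∣M) (∣m∣n⇒∣m+n d∣Y d∣Y)
    where
    M≡ : H + H ≡ (Y + Y) + (X + X)
    M≡ = trans (sym (cong₂ _+_ X+Y≡H X+Y≡H)) (solve 2 (λ x y → (x :+ y) :+ (x :+ y) := (y :+ y) :+ (x :+ x)) refl X Y)
      where open +-*-Solver

  complement-not-∣ : ∀ {X Y} → X + Y ≡ H → d ∣ Y → ¬ d ∣ X
  complement-not-∣ X+Y≡H d∣Y d∣X = d∤H (subst (d ∣_) X+Y≡H (∣m∣n⇒∣m+n d∣X d∣Y))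

  count-split-by : ∀ (P : ℕ → Bool) → count H P + count H (λ x → not (P x)) ≡ H
  count-split-by P = trans (sym (count-∧-not H (λ _ → true) P)) (count-true H)

  record IsNCr (S : BoolRel) : Set where
    field
      isEquivalenceOn : IsEquivalenceOn H S
      noncrossing : Noncrossing S
      special : ℕ
      special-< : special < H
      others-∣ : ∀ j → j < H → S special j ≡ false → d ∣ count H (S j)

  record IsNCtilde (R : BoolRel) : Set where
    field
      isEquivalenceOn : IsEquivalenceOn M R
      noncrossing : Noncrossing R
      invariant : ρ-Invariant R
      blocks-∣ : ∀ j → j < M → d ∣ count M (R j)

  module FromNCr {S : BoolRel} (P : IsNCr S) where
    open IsNCr P renaming (isEquivalenceOn to E; special to i₀; special-< to i₀H)
    open IsEquivalenceOn E

    c : ℕ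
    c = blockMin E i₀

    c-< : c < H
    c-< = blockMin-< E i₀H

    i₀∼c : S i₀ c ≡ true
    i₀∼c = blockMin-∼ E i₀H

    open Unfolding E c-< public

    outside-special-∣ : d ∣ count H (λ x → not (S i₀ x))
    outside-special-∣ = count-blockUnion-∣ E d (λ x → not (S i₀ x))
      (λ r → cong not (bool-ext (λ p → ∼-trans p r) (λ p → ∼-trans p (∼-sym r))))
      (λ j jH p → others-∣ j jH (trans (sym (not-involutive _)) (cong not p)))

    special-not-∣ : ¬ d ∣ count H (S i₀)
    special-not-∣ = complement-not-∣ {count H (S i₀)} (count-split-by (S i₀)) outside-special-∣

    unfold-blocks-∣ : ∀ i → i < M → d ∣ count M (unfold S c i)
    unfold-blocks-∣ i iM rewrite unfold-count iM with S c (residue i) in ci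
    ... | true = subst (d ∣_) (sym (cong₂ _+_ same-size same-size′))
                   (complement-double-∣ {count H (S i₀)} (count-split-by (S i₀)) outside-special-∣)
      where
      i₀∼i : S i₀ (residue i) ≡ true
      i₀∼i = ∼-trans i₀∼c ci
      same-size : count H (S (residue i)) ≡ count H (S i₀)
      same-size = Σ<-cong H λ y _ → cong indicator (sym (∼-row E i₀∼i y))
      same-size′ : count H (λ y → S (residue i) y ∧ true) ≡ count H (S i₀)
      same-size′ = trans (Σ<-cong H λ y _ → cong indicator (∧-identityʳ (S (residue i) y))) same-size
    ... | false = subst (d ∣_) (sym (trans (cong (count H (S (residue i)) +_) none) (+-identityʳ _)))
                    (others-∣ (residue i) (residue-< i) (¬-not λ p → true≢false (∼-trans (∼-sym i₀∼c) p) ci))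
      where
      none : count H (λ y → S (residue i) y ∧ false) ≡ 0
      none = Σ<-zero H _ λ y _ → cong indicator (∧-zeroʳ (S (residue i) y))

    unfold-isNCtilde : IsNCtilde (unfold S c)
    unfold-isNCtilde = record
      { isEquivalenceOn = unfold-isEquivalence
      ; noncrossing = unfold-noncrossing noncrossing
      ; invariant = unfold-invariant
      ; blocks-∣ = unfold-blocks-∣
      }

  module FromNCtilde {R : BoolRel} (P : IsNCtilde R) where
    open IsNCtilde P renaming (isEquivalenceOn to E; noncrossing to nc; invariant to inv)
    open IsEquivalenceOn E
    open Folding E inv public

    central : ℕ → Bool
    central x = R x (x + H)

    central₀ : ℕ
    central₀ = first central H

    -- Otherwise fold R would split [H] into blocks of size divisible by d.
    central₀-< : central₀ < H
    central₀-< with central₀ <? H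
    ... | yes lt = lt
    ... | no ≮H = ⊥-elim (d∤H (subst (d ∣_) (count-true H) all-∣))
      where
      not-central : ∀ {x} → x < H → central x ≡ false
      not-central {x} xH = ¬-not λ p → ≮H (≤-<-trans (proj₂ (first-minimal central H x p xH)) xH)
      all-∣ : d ∣ count H (λ _ → true)
      all-∣ = count-blockUnion-∣ fold-isEquivalence d (λ _ → true) (λ _ → refl)
        λ j jH _ → subst (d ∣_) (sym (fold-count jH (not-central jH))) (blocks-∣ j (<H⇒<M jH))

    central₀-central : central central₀ ≡ true
    central₀-central = first-<⇒satisfies central H central₀-<

    fold-others-∣ : ∀ j → j < H → fold R central₀ j ≡ false → d ∣ count H (fold R j)
    fold-others-∣ j jH not∼ with central j in cj
    ... | true = ⊥-elim (true≢false
          (within-intro central₀-< jH (∨-introˡ (central-∼ nc central₀-< jH central₀-central cj))) not∼)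
    ... | false = subst (d ∣_) (sym (fold-count jH cj)) (blocks-∣ j (<H⇒<M jH))

    fold-isNCr : IsNCr (fold R)
    fold-isNCr = record
      { isEquivalenceOn = fold-isEquivalence
      ; noncrossing = fold-noncrossing nc
      ; special = central₀
      ; special-< = central₀-<
      ; others-∣ = fold-others-∣
      }

    open FromNCr fold-isNCr public

    c-central : central c ≡ true
    c-central with ∨-elim (within-inner i₀∼c)
    ... | inj₁ r = ∼-trans (∼-trans (∼-sym r) central₀-central) (trans (shift-both central₀-< c-<) r)
    ... | inj₂ r = ∼-trans (trans (sym (shift-left c-< central₀-<)) (∼-sym r)) (∼-trans (∼-sym central₀-central) r)

    ρ-closed-at-c : ∀ {j} → j < M → R c (ρ j) ≡ true → R c j ≡ true
    ρ-closed-at-c {j} jM p = ∼-trans c-central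
      (subst₂ (λ u v → R u v ≡ true) (ρ-lower c-<) (ρ-involutive jM) (trans (inv c (ρ j) (<H⇒<M c-<) (ρ-< j)) p))

    fold-at-c : ∀ {i} → i < M → fold R c (residue i) ≡ R c i
    fold-at-c {i} iM = trans (cong (λ z → fold R z (residue i)) (sym (residue-lower c-<)))
      (trans (fold-residue (<H⇒<M c-<) iM) (bool-ext from-∨ ∨-introˡ))
      where
      from-∨ : (R c i ∨ R c (ρ i)) ≡ true → R c i ≡ true
      from-∨ p with ∨-elim p
      ... | inj₁ r = r
      ... | inj₂ r = ρ-closed-at-c iM r

    unfold-fold : unfold (fold R) c ≗₂ R
    unfold-fold i j = within-exact E λ iM jM →
      trans (cong₂ (λ u v → u ∧ (v ∨ (sheet c i == sheet c j))) (fold-residue iM jM) (fold-at-c iM))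
            (bool-ext (forth iM jM) back)
      where
      same-sheet : ∀ {x y} → R x y ≡ true → R c x ≡ false → sheet c x ≡ sheet c y
      same-sheet = interval-blockwise E nc c-central
      forth : i < M → j < M → ((R i j ∨ R i (ρ j)) ∧ (R c i ∨ (sheet c i == sheet c j))) ≡ true → R i j ≡ true
      forth iM jM p = cases (∨-elim (∧-elimˡ p)) (∧-elimʳ {R i j ∨ R i (ρ j)} p)
        where
        cases : R i j ≡ true ⊎ R i (ρ j) ≡ true → (R c i ∨ (sheet c i == sheet c j)) ≡ true →
          R i j ≡ true
        cases (inj₁ r) _ = r
        cases (inj₂ r) same with R c i in ci
        ... | true = ∼-trans (∼-sym ci) (ρ-closed-at-c jM (∼-trans ci r))
        ... | false = ⊥-elim (not-¬ (==⇒≡ _ _ same) (trans (same-sheet r ci) (sheet-ρ jM)))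
      back : R i j ≡ true → ((R i j ∨ R i (ρ j)) ∧ (R c i ∨ (sheet c i == sheet c j))) ≡ true
      back r with R c i in ci
      ... | true = ∧-intro (∨-introˡ r) refl
      ... | false = ∧-intro (∨-introˡ r) (≡⇒== _ _ (same-sheet r ci))

  module _ {S S′ : BoolRel} (P : IsNCr S) (P′ : IsNCr S′) (S⊆S′ : S ⊆₂ S′) where
    private
      module A = FromNCr P
      module B = FromNCr P′
      open IsNCr P using (others-∣) renaming (isEquivalenceOn to E; special to i₀; special-< to i₀H)
      open IsNCr P′ using () renaming (isEquivalenceOn to E′; noncrossing to nc′; special to i₀′; others-∣ to others′-∣)
      module E = IsEquivalenceOn E
      module E′ = IsEquivalenceOn E′

    -- The S′-block of i₀ is the special S-block plus ordinary S-blocks, so its size is not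
    -- divisible by d either: it is the special S′-block.
    special-⊆ : S′ i₀′ i₀ ≡ true
    special-⊆ = ¬-not λ e → A.special-not-∣ (∣m+n∣m⇒∣n (subst (d ∣_) split (others′-∣ i₀ i₀H e)) rest-∣)
      where
      rest : ℕ → Bool
      rest x = S′ i₀ x ∧ not (S i₀ x)
      rest-∣ : d ∣ count H rest
      rest-∣ = count-blockUnion-∣ E d rest
        (λ {x} {y} r → cong₂ (λ u v → u ∧ not v)
          (bool-ext (λ p → E′.∼-trans p (S⊆S′ x y r)) (λ p → E′.∼-trans p (E′.∼-sym (S⊆S′ x y r))))
          (bool-ext (λ p → E.∼-trans p r) (λ p → E.∼-trans p (E.∼-sym r))))
        (λ j jH p → others-∣ j jH (trans (sym (not-involutive _)) (cong not (∧-elimʳ {S′ i₀ j} p))))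
      split : count H (S′ i₀) ≡ count H rest + count H (S i₀)
      split = trans (count-∧-not H (S′ i₀) (S i₀))
        (trans (cong (_+ count H rest) (Σ<-cong H λ x _ → cong indicator
                 (bool-ext ∧-elimʳ λ p → ∧-intro (S⊆S′ i₀ x p) p)))
               (+-comm (count H (S i₀)) (count H rest)))

    private
      c′∼c : S′ B.c A.c ≡ true
      c′∼c = E′.∼-trans (E′.∼-sym B.i₀∼c) (E′.∼-trans special-⊆ (S⊆S′ _ _ A.i₀∼c))

      c′≤c : B.c ≤ A.c
      c′≤c = proj₂ (first-minimal (S′ i₀′) H A.c (E′.∼-trans special-⊆ (S⊆S′ _ _ A.i₀∼c)) A.c-<)

      between : ℕ → Bool
      between = interval B.c A.c

      sheet-change : ∀ {i} → i < M → sheet B.c i ≡ between (residue i) xor sheet A.c i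
      sheet-change iM with halfView iM
      ... | lowerHalf {x} xH rewrite residue-lower xH | A.sheet-lower xH | B.sheet-lower xH =
        flip-lower (x <ᵇ B.c) (x <ᵇ A.c) λ p → <⇒<ᵇ≡true (<-≤-trans (<ᵇ≡true⇒< p) c′≤c)
        where
        flip-lower : ∀ a b → (a ≡ true → b ≡ true) → not a ≡ (not a ∧ b) xor not b
        flip-lower true true _ = refl
        flip-lower true false h = ⊥-elim (true≢false (h refl) refl)
        flip-lower false true _ = refl
        flip-lower false false _ = refl
      ... | upperHalf {x} xH rewrite residue-upper xH | A.sheet-upper xH | B.sheet-upper xH =
        flip-upper (x <ᵇ B.c) (x <ᵇ A.c) λ p → <⇒<ᵇ≡true (<-≤-trans (<ᵇ≡true⇒< p) c′≤c)
        where
        flip-upper : ∀ a b → (a ≡ true → b ≡ true) → a ≡ (not a ∧ b) xor b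
        flip-upper true true _ = refl
        flip-upper true false h = ⊥-elim (true≢false (h refl) refl)
        flip-upper false true _ = refl
        flip-upper false false _ = refl

    unfold-mono : unfold S A.c ⊆₂ unfold S′ B.c
    unfold-mono i j u = within-intro iM jM (∧-intro (S⊆S′ _ _ t) (linked (∨-elim (∧-elimʳ {S (residue i) (residue j)} (within-inner u)))))
      where
      iM = proj₁ (within-bounded u)
      jM = proj₂ (within-bounded u)
      t : S (residue i) (residue j) ≡ true
      t = ∧-elimˡ (within-inner u)
      linked : S A.c (residue i) ≡ true ⊎ (sheet A.c i == sheet A.c j) ≡ true →
        (S′ B.c (residue i) ∨ (sheet B.c i == sheet B.c j)) ≡ true
      linked (inj₁ r) = ∨-introˡ (E′.∼-trans c′∼c (S⊆S′ _ _ r))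
      linked (inj₂ r) with S′ B.c (residue i) in e
      ... | true = refl
      ... | false = ≡⇒== _ _ (begin
        sheet B.c i                                    ≡⟨ sheet-change iM ⟩
        between (residue i) xor sheet A.c i            ≡⟨ cong₂ _xor_ (interval-blockwise E′ nc′ c′∼c (S⊆S′ _ _ t) e) (==⇒≡ _ _ r) ⟩
        between (residue j) xor sheet A.c j            ≡⟨ sheet-change jM ⟨
        sheet B.c j                                    ∎)
        where open ≡-Reasoning

-- The case d = 2k, H = k(2n + 1)

module Instance (n′ k′ : ℕ) where
  n k d s₀ : ℕ
  n = suc n′
  k = suc k′
  d = 2 * k
  s₀ = 2 * k * n + k

  -- s₀ is a successor, so H = suc (pred s₀) reduces to s₀.
  open Halves (pred s₀)

  M′ : ℕ
  M′ = 2 * k * (2 * n + 1)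

  M′≡M : M′ ≡ M
  M′≡M = solve 2 (λ k n → (con 2 :* k) :* (con 2 :* n :+ con 1) := (con 2 :* k :* n :+ k) :+ (con 2 :* k :* n :+ k)) refl k n
    where open +-*-Solver

  d∣M : d ∣ H + H
  d∣M = subst (d ∣_) M′≡M (m∣m*n (2 * n + 1))

  d∤H : ¬ d ∣ H
  d∤H d∣H = <⇒≱ (m<m+n k {k + 0} (s≤s z≤n)) (∣⇒≤ (∣m+n∣m⇒∣n d∣H (m∣m*n n)))

  open Correspondence (pred s₀) d d∣M d∤H

  <M′⇒<M : ∀ {i} → i < M′ → i < M
  <M′⇒<M {i} = subst (i <_) M′≡M

  shift-ρ : (a : Fin M′) → toℕ (shift s₀ a) ≡ ρ (toℕ a)
  shift-ρ a = trans (toℕ-fromℕ< _) (%-congʳ {o = toℕ a + s₀} M′≡M)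

  private
    <M⇒<M′ : ∀ {i} → i < M → i < M′
    <M⇒<M′ {i} = subst (i <_) (sym M′≡M)

  isNCtilde : (x : NCtilde k n) → IsNCtilde (toBoolRel (proj₁ (proj₁ x)))
  isNCtilde x = record
    { isEquivalenceOn = subst (λ m → IsEquivalenceOn m R) M′≡M (toBoolRel-isEquivalence π)
    ; noncrossing = toBoolRel-noncrossing π ncπ
    ; invariant = invariant
    ; blocks-∣ = blocks-∣
    }
    where
    π = proj₁ (proj₁ x)
    ncπ = proj₁ (proj₂ (proj₁ x))
    divπ = proj₂ (proj₂ (proj₁ x))
    invπ = proj₂ x
    R = toBoolRel π
    invariant : ρ-Invariant R
    invariant i j iM jM = begin
      R (ρ i) (ρ j)                           ≡⟨ cong₂ R (shift-ρ′ iM) (shift-ρ′ jM) ⟨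
      R (toℕ (shift s₀ a)) (toℕ (shift s₀ b)) ≡⟨ toBoolRel-toℕ π _ _ ⟩
      rel π (shift s₀ a) (shift s₀ b)         ≡⟨ bool-ext (proj₂ (invπ a b)) (proj₁ (invπ a b)) ⟩
      rel π a b                               ≡⟨ toBoolRel-fromℕ< π (<M⇒<M′ iM) (<M⇒<M′ jM) ⟨
      R i j                                   ∎
      where
      open ≡-Reasoning
      a b : Fin M′
      a = fromℕ< (<M⇒<M′ iM)
      b = fromℕ< (<M⇒<M′ jM)
      shift-ρ′ : ∀ {l} (lM : l < M) → toℕ (shift s₀ (fromℕ< (<M⇒<M′ lM))) ≡ ρ l
      shift-ρ′ lM = trans (shift-ρ (fromℕ< (<M⇒<M′ lM))) (cong ρ (toℕ-fromℕ< (<M⇒<M′ lM)))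
    blocks-∣ : ∀ j → j < M → d ∣ count M (R j)
    blocks-∣ j jM = subst (d ∣_) size (divπ (fromℕ< (<M⇒<M′ jM)))
      where
      size : blockSize π (fromℕ< (<M⇒<M′ jM)) ≡ count M (R j)
      size = trans (blockSize-≡-count π R (λ a b → sym (toBoolRel-toℕ π a b)) (fromℕ< (<M⇒<M′ jM)))
                   (cong₂ (λ m l → count m (R l)) M′≡M (toℕ-fromℕ< (<M⇒<M′ jM)))

  isNCr : (y : NCr d n k) → IsNCr (toBoolRel (proj₁ y))
  isNCr y = record
    { isEquivalenceOn = toBoolRel-isEquivalence σ
    ; noncrossing = toBoolRel-noncrossing σ ncσ
    ; special = toℕ i₀
    ; special-< = toℕ<n i₀
    ; others-∣ = others-∣
    }
    where
    σ = proj₁ y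
    ncσ = proj₁ (proj₂ y)
    i₀ = proj₁ (proj₂ (proj₂ y))
    others = proj₂ (proj₂ (proj₂ y))
    S = toBoolRel σ
    others-∣ : ∀ j → j < H → S (toℕ i₀) j ≡ false → d ∣ count H (S j)
    others-∣ j jH e = subst (d ∣_) size (others (fromℕ< jH) not∼)
      where
      size : blockSize σ (fromℕ< jH) ≡ count H (S j)
      size = trans (blockSize-≡-count σ S (λ a b → sym (toBoolRel-toℕ σ a b)) (fromℕ< jH))
                   (cong (λ l → count H (S l)) (toℕ-fromℕ< jH))
      not∼ : ¬ (σ ∋ i₀ ∼ fromℕ< jH)
      not∼ p = true≢false (trans (toBoolRel-fromℕ< σ (toℕ<n i₀) jH)
        (trans (cong (λ z → rel σ z (fromℕ< jH)) (fromℕ<-toℕ i₀ (toℕ<n i₀))) p)) e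

  fromIsNCtilde : ∀ {R} → IsNCtilde R → NCtilde k n
  fromIsNCtilde {R} P = (π , fromBoolRel-noncrossing R E′ noncrossing , blocks′-∣) , invariant′
    where
    open IsNCtilde P
    E′ : IsEquivalenceOn M′ R
    E′ = subst (λ m → IsEquivalenceOn m R) (sym M′≡M) isEquivalenceOn
    π : Partition M′
    π = fromBoolRel R E′
    blocks′-∣ : AllBlocksDiv d π
    blocks′-∣ i = subst (d ∣_)
      (sym (trans (blockSize-≡-count π R (λ _ _ → refl) i) (cong (λ m → count m (R (toℕ i))) M′≡M)))
      (blocks-∣ (toℕ i) (<M′⇒<M (toℕ<n i)))
    shifted : ∀ a b → rel π (shift s₀ a) (shift s₀ b) ≡ rel π a b
    shifted a b = trans (cong₂ R (shift-ρ a) (shift-ρ b))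
      (invariant (toℕ a) (toℕ b) (<M′⇒<M (toℕ<n a)) (<M′⇒<M (toℕ<n b)))
    invariant′ : Invariant (shift s₀) π
    invariant′ a b = (λ p → trans (shifted a b) p) , (λ p → trans (sym (shifted a b)) p)

  fromIsNCr : ∀ {S} → IsNCr S → NCr d n k
  fromIsNCr {S} P = σ , fromBoolRel-noncrossing S isEquivalenceOn noncrossing , fromℕ< special-< , others
    where
    open IsNCr P
    σ : Partition H
    σ = fromBoolRel S isEquivalenceOn
    others : ∀ j → ¬ (σ ∋ fromℕ< special-< ∼ j) → d ∣ blockSize σ j
    others j not∼ = subst (d ∣_) (sym (blockSize-≡-count σ S (λ _ _ → refl) j))
      (others-∣ (toℕ j) (toℕ<n j)
        (¬-not λ p → not∼ (subst (λ z → S z (toℕ j) ≡ true) (sym (toℕ-fromℕ< special-<)) p)))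

  foldNC : NCtilde k n → NCr d n k
  foldNC x = fromIsNCr (FromNCtilde.fold-isNCr (isNCtilde x))

  unfoldNC : NCr d n k → NCtilde k n
  unfoldNC y = fromIsNCtilde (FromNCr.unfold-isNCtilde (isNCr y))

  foldNC-mono : ∀ {x y} → _≤NCtilde_ {k} {n} x y → _≤NCr_ {d} {n} {k} (foldNC x) (foldNC y)
  foldNC-mono {x} {y} x≤y a b = fold-mono (toBoolRel-mono (proj₁ (proj₁ x)) (proj₁ (proj₁ y)) x≤y) (toℕ a) (toℕ b)

  unfoldNC-mono : ∀ {x y} → _≤NCr_ {d} {n} {k} x y → _≤NCtilde_ {k} {n} (unfoldNC x) (unfoldNC y)
  unfoldNC-mono {x} {y} x≤y a b = unfold-mono (isNCr x) (isNCr y) (toBoolRel-mono (proj₁ x) (proj₁ y) x≤y) (toℕ a) (toℕ b)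

  foldNC-unfoldNC : ∀ y a b → rel (proj₁ (foldNC (unfoldNC y))) a b ≡ rel (proj₁ y) a b
  foldNC-unfoldNC y a b = begin
    fold (toBoolRel π) (toℕ a) (toℕ b)        ≡⟨ fold-cong (toBoolRel-fromBoolRel (unfold S c) E′) (toℕ a) (toℕ b) ⟩
    fold (unfold S c) (toℕ a) (toℕ b)         ≡⟨ fold-unfold (toℕ a) (toℕ b) ⟩
    S (toℕ a) (toℕ b)                         ≡⟨ toBoolRel-toℕ (proj₁ y) a b ⟩
    rel (proj₁ y) a b                         ∎
    where
    open ≡-Reasoning
    open FromNCr (isNCr y)
    S = toBoolRel (proj₁ y)
    π = proj₁ (proj₁ (unfoldNC y))
    E′ = subst (λ m → IsEquivalenceOn m (unfold S c)) (sym M′≡M) unfold-isEquivalence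

  unfoldNC-foldNC : ∀ x a b → rel (proj₁ (proj₁ (unfoldNC (foldNC x)))) a b ≡ rel (proj₁ (proj₁ x)) a b
  unfoldNC-foldNC x a b = begin
    unfold (toBoolRel σ) Y.c (toℕ a) (toℕ b)
      ≡⟨ unfold-cong (toBoolRel-fromBoolRel (fold R) X.fold-isEquivalence) Y.c (toℕ a) (toℕ b) ⟩
    unfold (fold R) Y.c (toℕ a) (toℕ b)  ≡⟨ cong (λ z → unfold (fold R) z (toℕ a) (toℕ b)) same-c ⟩
    unfold (fold R) X.c (toℕ a) (toℕ b)  ≡⟨ X.unfold-fold (toℕ a) (toℕ b) ⟩
    R (toℕ a) (toℕ b)                    ≡⟨ toBoolRel-toℕ (proj₁ (proj₁ x)) a b ⟩
    rel (proj₁ (proj₁ x)) a b            ∎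
    where
    open ≡-Reasoning
    R = toBoolRel (proj₁ (proj₁ x))
    σ = proj₁ (foldNC x)
    module X = FromNCtilde (isNCtilde x)
    module Y = FromNCr (isNCr (foldNC x))
    same-c : Y.c ≡ X.c
    same-c = trans (cong (λ z → first (toBoolRel σ z) H) (toℕ-fromℕ< X.central₀-<))
      (first-cong _ _ H (toBoolRel-fromBoolRel (fold R) X.fold-isEquivalence X.central₀))

theorem6p1 : (n k : ℕ) → n ≥ 1 → k ≥ 1 →
    OrderIso (_≤NCtilde_ {k} {n}) (_≤NCr_ {2 * k} {n} {k})
theorem6p1 (suc n′) (suc k′) _ _ = record
  { to = foldNC
  ; from = unfoldNC
  ; to-mono = λ {x} {y} → foldNC-mono {x} {y}
  ; from-mono = λ {x} {y} → unfoldNC-mono {x} {y}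
  ; from-to = λ x → ≡-rel⇒⊑× (proj₁ (proj₁ (unfoldNC (foldNC x)))) (proj₁ (proj₁ x)) (unfoldNC-foldNC x)
  ; to-from = λ y → ≡-rel⇒⊑× (proj₁ (foldNC (unfoldNC y))) (proj₁ y) (foldNC-unfoldNC y)
  }
  where open Instance n′ k′
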